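{- Let $G$ be a well-edge-dominated graph and let $M$ be any matching in $G$. Then the graph $G-N_e[M]$ is well-edge-dominated.
   Context: All graphs are finite and simple. For an edge $f$, $N_e[f]$ is the set consisting of $f$ and all edges sharing an endpoint with $f$; for a set $F$ of edges, $N_e[F]=\bigcup_{f\in F}N_e[f]$. For $X\subseteq E(G)$, $G-X$ is the graph with vertex set $V(G)$ and edge set $E(G)\setminus X$. A set $F$ of edges is an edge dominating set if $N_e[F]=E(G)$; it is minimal if no proper subset is an edge dominating set. A graph is well-edge-dominated if all its minimal edge dominating sets have the same cardinality. -}

module Defs where

open import Data.Nat using (ℕ)
open import Data.Fin using (Fin; _≟_)
open import Data.Fin.Subset using (Subset; _∈_; _⊆_; _⊂_; ∣_∣; ⊤; _─_)
open import Data.Fin.Subset.Properties using (_∈?_)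
open import Data.Fin.Properties using (any?)
open import Data.Product using (_×_; _,_; proj₁; proj₂; Σ)
open import Data.Sum using (_⊎_)
open import Data.Vec using (tabulate)
open import Relation.Nullary using (¬_; Dec)
open import Relation.Nullary.Decidable using (⌊_⌋; _×-dec_; _⊎-dec_)
open import Relation.Binary.PropositionalEquality using (_≡_; _≢_)

record Graph (n : ℕ) : Set where
  field
    m      : ℕ
    end₁   : Fin m → Fin n
    end₂   : Fin m → Fin n
    loopless : ∀ e → end₁ e ≢ end₂ e
    simple : ∀ e f → ((end₁ e ≡ end₁ f × end₂ e ≡ end₂ f) ⊎
                      (end₁ e ≡ end₂ f × end₂ e ≡ end₁ f)) → e ≡ f

module _ {n : ℕ} (G : Graph n) where
  open Graph G

  Incident : Fin n → Fin m → Set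
  Incident v e = (v ≡ end₁ e) ⊎ (v ≡ end₂ e)

  Share : Fin m → Fin m → Set
  Share e f = Σ (Fin n) λ v → Incident v e × Incident v f

  share? : ∀ e f → Dec (Share e f)
  share? e f = any? λ v → ((v ≟ end₁ e) ⊎-dec (v ≟ end₂ e))
                          ×-dec ((v ≟ end₁ f) ⊎-dec (v ≟ end₂ f))

  Ne : Subset m → Subset m
  Ne F = tabulate λ e → ⌊ any? (λ f → (f ∈? F) ×-dec share? e f) ⌋

  -- We consider spanning subgraphs H of G (vertex set V(G)) given by their
  -- edge set A ⊆ E(G).  G itself is A = ⊤; G - X is A = ⊤ ─ X.

  IsEDS : Subset m → Subset m → Set
  IsEDS A F = F ⊆ A × (∀ {e} → e ∈ A → e ∈ Ne F)

  IsMinimalEDS : Subset m → Subset m → Set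
  IsMinimalEDS A F = IsEDS A F × (∀ F′ → F′ ⊂ F → ¬ IsEDS A F′)

  WellEdgeDominated : Subset m → Set
  WellEdgeDominated A =
    ∀ F F′ → IsMinimalEDS A F → IsMinimalEDS A F′ → ∣ F ∣ ≡ ∣ F′ ∣

  IsMatching : Subset m → Set
  IsMatching M = ∀ {e f} → e ∈ M → f ∈ M → e ≢ f → ¬ Share e f

-- Adding a matching M to a minimal edge dominating set F of G − N_e[M]
-- gives a minimal edge dominating set of G: the edges of N_e[M] are
-- dominated by M, and minimality survives because no edge of F touches M
-- and no two edges of M touch each other. As F and M are disjoint,
-- |F ∪ M| = |F| + |M|, so two minimal edge dominating sets of G − N_e[M]
-- of different sizes would yield two of G of different sizes.
module Submission where

open import Defs
open import Data.Nat using (ℕ; suc; _+_)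
open import Data.Nat.Properties using (+-cancelʳ-≡; +-suc)
open import Data.Fin using (_≟_)
open import Data.Fin.Subset
  using (Subset; ⊤; _─_; _∈_; _∉_; _∪_; _∩_; ∣_∣; inside; outside; _⊆_; _⊂_)
open import Data.Fin.Subset.Properties
  using (_∈?_; ∈⊤; x∈p∪q⁻; x∈p∪q⁺; x∈p∩q⁻; x∈p∩q⁺; x∈p∧x∉q⇒x∈p─q; p⊆p∪q; q⊆p∪q)
open import Data.Fin.Properties using (any?)
open import Data.Vec using ([]; _∷_; here; there; lookup)
open import Data.Vec.Properties using ([]=⇒lookup; lookup⇒[]=; lookup∘tabulate)
open import Data.Product using (∃; _×_; _,_; proj₁; proj₂)
open import Data.Sum using (inj₁; inj₂)
open import Relation.Nullary using (¬_; Dec; yes; no; contradiction)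
open import Relation.Nullary.Decidable using (_×-dec_; isYes; does; isYes≗does; dec-true)
open import Relation.Binary.PropositionalEquality using (_≡_; refl; sym; trans; cong; module ≡-Reasoning)
open ≡-Reasoning

x∈p─q⇒x∉q : ∀ {n} (p q : Subset n) {x} → x ∈ p ─ q → x ∉ q
x∈p─q⇒x∉q (_ ∷ p) (inside  ∷ q) (there x∈p─q) (there x∈q) = x∈p─q⇒x∉q p q x∈p─q x∈q
x∈p─q⇒x∉q (_ ∷ p) (outside ∷ q) (there x∈p─q) (there x∈q) = x∈p─q⇒x∉q p q x∈p─q x∈q

∣p∪q∣≡∣p∣+∣q∣ : ∀ {n} (p q : Subset n) → (∀ {x} → x ∈ p → x ∉ q) → ∣ p ∪ q ∣ ≡ ∣ p ∣ + ∣ q ∣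
∣p∪q∣≡∣p∣+∣q∣ []            []            _        = refl
∣p∪q∣≡∣p∣+∣q∣ (inside  ∷ p) (inside  ∷ q) disjoint = contradiction here (disjoint here)
∣p∪q∣≡∣p∣+∣q∣ (inside  ∷ p) (outside ∷ q) disjoint =
  cong suc (∣p∪q∣≡∣p∣+∣q∣ p q λ x∈p x∈q → disjoint (there x∈p) (there x∈q))
∣p∪q∣≡∣p∣+∣q∣ (outside ∷ p) (inside  ∷ q) disjoint = begin
  suc ∣ p ∪ q ∣     ≡⟨ cong suc (∣p∪q∣≡∣p∣+∣q∣ p q λ x∈p x∈q → disjoint (there x∈p) (there x∈q)) ⟩
  suc (∣ p ∣ + ∣ q ∣) ≡⟨ sym (+-suc ∣ p ∣ ∣ q ∣) ⟩
  ∣ p ∣ + suc ∣ q ∣   ∎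
∣p∪q∣≡∣p∣+∣q∣ (outside ∷ p) (outside ∷ q) disjoint =
  ∣p∪q∣≡∣p∣+∣q∣ p q λ x∈p x∈q → disjoint (there x∈p) (there x∈q)

module _ {n : ℕ} (G : Graph n) where
  open Graph G

  Share-refl : ∀ e → Share G e e
  Share-refl e = end₁ e , inj₁ refl , inj₁ refl

  Share-sym : ∀ {e f} → Share G e f → Share G f e
  Share-sym (v , v∈e , v∈f) = v , v∈f , v∈e

  dominated? : ∀ F e → Dec (∃ λ f → f ∈ F × Share G e f)
  dominated? F e = any? λ f → (f ∈? F) ×-dec share? G e f

  ∈Ne⁺ : ∀ {F e f} → f ∈ F → Share G e f → e ∈ Ne G F
  ∈Ne⁺ {F} {e} f∈F share = lookup⇒[]= e (Ne G F) (begin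
    lookup (Ne G F) e       ≡⟨ lookup∘tabulate _ e ⟩
    isYes (dominated? F e)  ≡⟨ isYes≗does (dominated? F e) ⟩
    does (dominated? F e)   ≡⟨ dec-true (dominated? F e) (_ , f∈F , share) ⟩
    inside                  ∎)

  ∈Ne⁻ : ∀ {F e} → e ∈ Ne G F → ∃ λ f → f ∈ F × Share G e f
  ∈Ne⁻ {F} {e} e∈NeF
    with dominated? F e | trans (sym (lookup∘tabulate _ e)) ([]=⇒lookup e∈NeF)
  ... | yes dominator | _ = dominator
  ... | no _          | ()

  F⊆NeF : ∀ {F} → F ⊆ Ne G F
  F⊆NeF {x = e} e∈F = ∈Ne⁺ e∈F (Share-refl e)

  Ne-mono : ∀ {F F′} → F ⊆ F′ → Ne G F ⊆ Ne G F′
  Ne-mono F⊆F′ e∈NeF with ∈Ne⁻ e∈NeF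
  ... | f , f∈F , share = ∈Ne⁺ (F⊆F′ f∈F) share

  module _ {M : Subset m} (matching : IsMatching G M) where

    private
      A : Subset m
      A = ⊤ ─ Ne G M

    ∪-dominates : ∀ {F} → IsEDS G A F → IsEDS G ⊤ (F ∪ M)
    ∪-dominates {F} (_ , F-dominates) = (λ _ → ∈⊤) , dominates
      where
      dominates : ∀ {e} → e ∈ ⊤ → e ∈ Ne G (F ∪ M)
      dominates {e} _ with e ∈? Ne G M
      ... | yes e∈NeM = Ne-mono (q⊆p∪q F M) e∈NeM
      ... | no  e∉NeM = Ne-mono (p⊆p∪q M) (F-dominates (x∈p∧x∉q⇒x∈p─q ∈⊤ e∉NeM))

    -- An edge x of M can only be dominated by x itself: edges of F avoid
    -- N_e[M], and other edges of M are disjoint from x.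
    M⊆EDS : ∀ {F F′} → F ⊆ A → F′ ⊆ F ∪ M → IsEDS G ⊤ F′ → M ⊆ F′
    M⊆EDS {F} F⊆A F′⊆F∪M (_ , F′-dominates) {x} x∈M
      with ∈Ne⁻ (F′-dominates (∈⊤ {x = x}))
    ... | f , f∈F′ , share with x∈p∪q⁻ F M (F′⊆F∪M f∈F′)
    ...   | inj₁ f∈F = contradiction (∈Ne⁺ x∈M (Share-sym share)) (x∈p─q⇒x∉q ⊤ (Ne G M) (F⊆A f∈F))
    ...   | inj₂ f∈M with x ≟ f
    ...     | yes refl = f∈F′
    ...     | no  x≢f  = contradiction share (matching x∈M f∈M x≢f)

    ∩-dominates : ∀ {F F′} → F ⊆ A → F′ ⊆ F ∪ M → IsEDS G ⊤ F′ → IsEDS G A (F′ ∩ F)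
    ∩-dominates {F} {F′} F⊆A F′⊆F∪M (_ , F′-dominates) =
      (λ e∈F′∩F → F⊆A (proj₂ (x∈p∩q⁻ F′ F e∈F′∩F))) , dominates
      where
      dominates : ∀ {e} → e ∈ A → e ∈ Ne G (F′ ∩ F)
      dominates {e} e∈A with ∈Ne⁻ (F′-dominates (∈⊤ {x = e}))
      ... | f , f∈F′ , share with x∈p∪q⁻ F M (F′⊆F∪M f∈F′)
      ...   | inj₁ f∈F = ∈Ne⁺ (x∈p∩q⁺ (f∈F′ , f∈F)) share
      ...   | inj₂ f∈M = contradiction (∈Ne⁺ f∈M share) (x∈p─q⇒x∉q ⊤ (Ne G M) e∈A)

    ∪-minimal : ∀ {F} → IsMinimalEDS G A F → IsMinimalEDS G ⊤ (F ∪ M)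
    ∪-minimal {F} (F-eds@(F⊆A , _) , F-minimal) = ∪-dominates F-eds , minimal
      where
      minimal : ∀ F′ → F′ ⊂ F ∪ M → ¬ IsEDS G ⊤ F′
      minimal F′ (F′⊆F∪M , x , x∈F∪M , x∉F′) F′-eds with x∈p∪q⁻ F M x∈F∪M
      ... | inj₂ x∈M = x∉F′ (M⊆EDS F⊆A F′⊆F∪M F′-eds x∈M)
      ... | inj₁ x∈F = F-minimal (F′ ∩ F) F′∩F⊂F (∩-dominates F⊆A F′⊆F∪M F′-eds)
        where
        F′∩F⊂F : F′ ∩ F ⊂ F
        F′∩F⊂F = (λ y∈F′∩F → proj₂ (x∈p∩q⁻ F′ F y∈F′∩F))
               , x , x∈F , λ x∈F′∩F → x∉F′ (proj₁ (x∈p∩q⁻ F′ F x∈F′∩F))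

    ∣F∪M∣≡∣F∣+∣M∣ : ∀ {F} → F ⊆ A → ∣ F ∪ M ∣ ≡ ∣ F ∣ + ∣ M ∣
    ∣F∪M∣≡∣F∣+∣M∣ {F} F⊆A = ∣p∪q∣≡∣p∣+∣q∣ F M λ x∈F x∈M →
      x∈p─q⇒x∉q ⊤ (Ne G M) (F⊆A x∈F) (F⊆NeF x∈M)

lemma3 : ∀ {n : ℕ} (G : Graph n) (M : Subset (Graph.m G)) →
           WellEdgeDominated G ⊤ →
           IsMatching G M →
           WellEdgeDominated G (⊤ ─ Ne G M)
lemma3 G M well-dominated matching F F′ F-min@((F⊆A , _) , _) F′-min@((F′⊆A , _) , _) =
  +-cancelʳ-≡ (∣ M ∣) (∣ F ∣) (∣ F′ ∣) (begin
    ∣ F ∣ + ∣ M ∣   ≡⟨ sym (∣F∪M∣≡∣F∣+∣M∣ G matching F⊆A) ⟩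
    ∣ F ∪ M ∣      ≡⟨ well-dominated _ _ (∪-minimal G matching F-min) (∪-minimal G matching F′-min) ⟩
    ∣ F′ ∪ M ∣     ≡⟨ ∣F∪M∣≡∣F∣+∣M∣ G matching F′⊆A ⟩
    ∣ F′ ∣ + ∣ M ∣  ∎)
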